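{- Fix an integer $\delta$. Let $H$ be a connected, non-regular graph (without multiple edges, loops allowed), and let $\Delta$ be the maximum degree of a vertex of $H$. Then there exists a constant $\ell$ (depending on $\delta$ and $H$) such that for every $k \geq \ell$, $\hom(P_k,H) < \Delta^{k-\delta}$.
   Context: $P_k$ denotes the path on $k$ vertices. For graphs $G$ and $H$, an $H$-coloring of $G$ is a map $f:V(G)\to V(H)$ such that $f(v)\sim_H f(w)$ whenever $v\sim_G w$, and $\hom(G,H)$ is the number of $H$-colorings of $G$. The degree of a vertex $v$ of $H$ is $|\{w : v\sim w\}|$, so a loop at $v$ adds one to its degree; $H$ is regular if all vertices have the same degree. -}

module Defs where

open import Data.Nat using (ℕ; zero; suc; _+_; _*_; _^_; _<_; _⊔_)
open import Data.Integer using (ℤ; +_; -[1+_])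
open import Data.Bool using (Bool; true; false; _∧_; _∨_; not; if_then_else_)
open import Data.Fin using (Fin; toℕ)
open import Data.List using (List; []; _∷_; map; concatMap; foldr; length; filter; allFin)
open import Data.Nat.ListAction using (sum)
open import Data.Bool.ListAction using (and)
open import Data.Vec using (Vec; []; _∷_; lookup)
open import Relation.Binary.PropositionalEquality using (_≡_)
open import Relation.Nullary using (¬_)
open import Data.Product using (∃₂; _×_)
open import Data.Bool using (T?)

-- A finite graph on vertex set Fin size, given by a symmetric Bool-valued
-- adjacency relation. Loops (adj v v ≡ true) are allowed; multiple edges
-- cannot occur.
record Graph : Set where
  field
    size : ℕ
    adj  : Fin size → Fin size → Bool
    sym  : ∀ v w → adj v w ≡ adj w v
open Graph public

-- degree v = |{ w : v ~ w }| (a loop at v contributes one)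
degree : (H : Graph) → Fin (size H) → ℕ
degree H v = sum (map (λ w → if adj H v w then 1 else 0) (allFin (size H)))

maxDegree : Graph → ℕ
maxDegree H = foldr _⊔_ 0 (map (degree H) (allFin (size H)))

Regular : Graph → Set
Regular H = ∀ v w → degree H v ≡ degree H w

data Reach (H : Graph) : Fin (size H) → Fin (size H) → Set where
  here : ∀ {v} → Reach H v v
  step : ∀ {u w v} → adj H u w ≡ true → Reach H w v → Reach H u v

Connected : Graph → Set
Connected H = ∀ u v → Reach H u v

adjPath : (k : ℕ) → Fin k → Fin k → Bool
adjPath k i j = (suc (toℕ i) Data.Nat.≡ᵇ toℕ j) ∨ (suc (toℕ j) Data.Nat.≡ᵇ toℕ i)

allVecs : (n k : ℕ) → List (Vec (Fin n) k)
allVecs n zero    = [] ∷ []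
allVecs n (suc k) = concatMap (λ x → map (x ∷_) (allVecs n k)) (allFin n)

isHom : (m : ℕ) → (Fin m → Fin m → Bool) → (H : Graph) → Vec (Fin (size H)) m → Bool
isHom m adjG H f =
  and (map (λ i → and (map (λ j → not (adjG i j) ∨ adj H (lookup f i) (lookup f j)) (allFin m))) (allFin m))

homPath : ℕ → Graph → ℕ
homPath k H = length (filter (λ f → T? (isHom k (adjPath k) H f)) (allVecs (size H) k))

-- m < Δ ^ e for an integer exponent e (over the rationals):
-- for e = +n this is m < Δ^n; for e = -(n+1) it is m < 1 / Δ^(n+1),
-- i.e. m * Δ^(n+1) < 1.
_<pow_^_ : ℕ → ℕ → ℤ → Set
m <pow Δ ^ (+ n)     = m < Δ ^ n
m <pow Δ ^ -[1+ n ]  = m * Δ ^ suc n < 1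

_−ℤ_ : ℕ → ℤ → ℤ
k −ℤ δ = (+ k) Data.Integer.- δ

-- Let u be a vertex of degree below Δ and m − 1 a bound on the distance from
-- every vertex to u. A walk of length m from any vertex can be steered into u,
-- where it loses at least one of its Δ choices, so every vertex starts at most
-- c = Δ^m − 1 walks of length m. Hence hom(P_{k+1}, H) ≤ |H| Δ^r c^q for
-- k = r + qm, and the Bernoulli-type bound K c^Q < (c+1)^Q = Δ^{mQ} for
-- Q = Kc + 1 beats any prescribed factor K = |H| Δ^D.
module Submission where

open import Data.Bool using (Bool; true; false; _∧_; _∨_; not; if_then_else_; T?)
open import Data.Bool.ListAction using (and)
open import Data.Empty using (⊥-elim)
open import Data.Fin using (Fin; zero; suc)
open import Data.Fin.Properties using (any?)
open import Data.Integer as ℤ using (ℤ; -[1+_])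
open import Data.Integer.Properties using (m-n≡m⊖n; ⊖-≥)
open import Data.List using (List; []; _∷_; map; concatMap; concat; foldr; length; filter; allFin; tabulate; _++_)
open import Data.List.Membership.Propositional using (_∈_)
open import Data.List.Membership.Propositional.Properties using (∈-allFin)
open import Data.List.Properties using (map-cong; length-tabulate)
open import Data.List.Relation.Unary.Any using (here; there)
open import Data.Nat
open import Data.Nat.ListAction using (sum)
open import Data.Nat.Properties
open import Algebra.Properties.CommutativeSemigroup +-commutativeSemigroup using (xy∙z≈xz∙y)
open import Data.Nat.Tactic.RingSolver using (solve-∀)
open import Data.Product using (∃; _,_)
open import Data.Vec using (Vec; []; _∷_; lookup)
open import Function using (id; _∘_)
open import Relation.Binary.PropositionalEquality
open import Relation.Nullary using (¬_; yes; no)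

open import Defs hiding (sym)

private
  variable
    A B : Set

Eventually : (ℕ → Set) → Set
Eventually P = ∃ λ ℓ → ∀ k → k ≥ ℓ → P k

-- Counting and summing over lists

count : (A → Bool) → List A → ℕ
count p []       = 0
count p (x ∷ xs) = if p x then suc (count p xs) else count p xs

length-filter-T? : (p : A → Bool) (xs : List A) → length (filter (T? ∘ p) xs) ≡ count p xs
length-filter-T? p []       = refl
length-filter-T? p (x ∷ xs) with p x
... | true  = cong suc (length-filter-T? p xs)
... | false = length-filter-T? p xs

count-mono : (p q : A → Bool) → (∀ x → p x ≡ true → q x ≡ true) → ∀ xs → count p xs ≤ count q xs
count-mono p q p⇒q []       = z≤n
count-mono p q p⇒q (x ∷ xs) with p x in px | q x in qx
... | true  | true  = s≤s (count-mono p q p⇒q xs)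
... | true  | false with () ← trans (sym (p⇒q x px)) qx
... | false | true  = m≤n⇒m≤1+n (count-mono p q p⇒q xs)
... | false | false = count-mono p q p⇒q xs

count-++ : (p : A → Bool) (xs ys : List A) → count p (xs ++ ys) ≡ count p xs + count p ys
count-++ p []       ys = refl
count-++ p (x ∷ xs) ys with p x
... | true  = cong suc (count-++ p xs ys)
... | false = count-++ p xs ys

count-concatMap : (p : B → Bool) (f : A → List B) (xs : List A) →
                  count p (concatMap f xs) ≡ sum (map (count p ∘ f) xs)
count-concatMap p f []       = refl
count-concatMap p f (x ∷ xs) =
  trans (count-++ p (f x) (concat (map f xs))) (cong (count p (f x) +_) (count-concatMap p f xs))

count-map : (p : B → Bool) (f : A → B) (xs : List A) → count p (map f xs) ≡ count (p ∘ f) xs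
count-map p f []       = refl
count-map p f (x ∷ xs) with p (f x)
... | true  = cong suc (count-map p f xs)
... | false = count-map p f xs

count-const∧ : (b : Bool) (p : A → Bool) (xs : List A) →
               count (λ x → b ∧ p x) xs ≡ (if b then count p xs else 0)
count-const∧ true  p xs       = refl
count-const∧ false p []       = refl
count-const∧ false p (x ∷ xs) = count-const∧ false p xs

and-map-tabulate : ∀ {m} (g : A → Bool) (h : Fin m → A) → and (map g (tabulate h)) ≡ true →
                   ∀ i → g (h i) ≡ true
and-map-tabulate {m = suc m} g h all-true i with g (h zero) in g₀
and-map-tabulate {m = suc m} g h all-true zero    | true = g₀
and-map-tabulate {m = suc m} g h all-true (suc i) | true = and-map-tabulate g (h ∘ suc) all-true i

foldr-⊔-upper : (f : A → ℕ) {x : A} (xs : List A) → x ∈ xs → f x ≤ foldr _⊔_ 0 (map f xs)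
foldr-⊔-upper f (y ∷ xs) (here refl) = m≤m⊔n (f y) _
foldr-⊔-upper f (y ∷ xs) (there x∈xs) = ≤-trans (foldr-⊔-upper f xs x∈xs) (m≤n⊔m (f y) _)

sum-≤-length* : (f : A → ℕ) {X : ℕ} → (∀ x → f x ≤ X) → ∀ xs → sum (map f xs) ≤ length xs * X
sum-≤-length* f f≤X []       = z≤n
sum-≤-length* f f≤X (x ∷ xs) = +-mono-≤ (f≤X x) (sum-≤-length* f f≤X xs)

sum-if-≤ : (c : A → Bool) (f : A → ℕ) {X : ℕ} → (∀ x → f x ≤ X) → ∀ xs →
           sum (map (λ x → if c x then f x else 0) xs) ≤ sum (map (λ x → if c x then 1 else 0) xs) * X
sum-if-≤ c f f≤X []       = z≤n
sum-if-≤ c f f≤X (x ∷ xs) with c x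
... | true  = +-mono-≤ (f≤X x) (sum-if-≤ c f f≤X xs)
... | false = sum-if-≤ c f f≤X xs

sum-if-slack : (c : A → Bool) (f : A → ℕ) {X B : ℕ} → (∀ x → f x ≤ X) →
               ∀ {w} → c w ≡ true → f w + B ≤ X → ∀ xs → w ∈ xs →
               sum (map (λ x → if c x then f x else 0) xs) + B ≤ sum (map (λ x → if c x then 1 else 0) xs) * X
sum-if-slack c f f≤X {w} cw slack (w ∷ xs) (here refl) rewrite cw =
  ≤-trans (≤-reflexive (xy∙z≈xz∙y (f w) _ _)) (+-mono-≤ slack (sum-if-≤ c f f≤X xs))
sum-if-slack c f {B = B} f≤X cw slack (x ∷ xs) (there w∈xs) with c x
... | true  = ≤-trans (≤-reflexive (+-assoc (f x) _ B)) (+-mono-≤ (f≤X x) (sum-if-slack c f f≤X cw slack xs w∈xs))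
... | false = sum-if-slack c f f≤X cw slack xs w∈xs

-- Walks

module _ (H : Graph) where

  isWalk : ∀ {k} → Vec (Fin (size H)) k → Bool
  isWalk []          = true
  isWalk (x ∷ [])    = true
  isWalk (x ∷ y ∷ f) = adj H x y ∧ isWalk (y ∷ f)

  walkCount : ℕ → Fin (size H) → ℕ
  walkCount zero    v = 1
  walkCount (suc k) v = sum (map (λ w → if adj H v w then walkCount k w else 0) (allFin (size H)))

  count-walks-from : ∀ k v → count (λ f → isWalk (v ∷ f)) (allVecs (size H) k) ≡ walkCount k v
  count-walks-from zero    v = refl
  count-walks-from (suc k) v =
    trans (count-concatMap _ (λ w → map (w ∷_) (allVecs (size H) k)) (allFin (size H)))
          (cong sum (map-cong count-via (allFin (size H))))
    where
    count-via : ∀ w → count (λ f → isWalk (v ∷ f)) (map (w ∷_) (allVecs (size H) k))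
                    ≡ (if adj H v w then walkCount k w else 0)
    count-via w = begin
      count (λ f → isWalk (v ∷ f)) (map (w ∷_) (allVecs (size H) k))
        ≡⟨ count-map _ (w ∷_) (allVecs (size H) k) ⟩
      count (λ f → adj H v w ∧ isWalk (w ∷ f)) (allVecs (size H) k)
        ≡⟨ count-const∧ (adj H v w) _ (allVecs (size H) k) ⟩
      (if adj H v w then count (λ f → isWalk (w ∷ f)) (allVecs (size H) k) else 0)
        ≡⟨ cong (λ n → if adj H v w then n else 0) (count-walks-from k w) ⟩
      (if adj H v w then walkCount k w else 0) ∎
      where open ≡-Reasoning

  count-walks : ∀ k → count isWalk (allVecs (size H) (suc k)) ≡ sum (map (walkCount k) (allFin (size H)))
  count-walks k =
    trans (count-concatMap _ (λ v → map (v ∷_) (allVecs (size H) k)) (allFin (size H)))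
          (cong sum (map-cong (λ v → trans (count-map _ (v ∷_) (allVecs (size H) k)) (count-walks-from k v))
                              (allFin (size H))))

  consecutive⇒isWalk : ∀ k (f : Vec (Fin (size H)) k) →
                       (∀ i j → adjPath k i j ≡ true → adj H (lookup f i) (lookup f j) ≡ true) → isWalk f ≡ true
  consecutive⇒isWalk zero          []          _    = refl
  consecutive⇒isWalk (suc zero)    (x ∷ [])    _    = refl
  consecutive⇒isWalk (suc (suc k)) (x ∷ y ∷ f) edge =
    both (edge zero (suc zero) refl) (consecutive⇒isWalk (suc k) (y ∷ f) (λ i j → edge (suc i) (suc j)))
    where
    both : ∀ {a b} → a ≡ true → b ≡ true → a ∧ b ≡ true
    both refl b = b

  isHom⇒isWalk : ∀ k f → isHom k (adjPath k) H f ≡ true → isWalk f ≡ true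
  isHom⇒isWalk k f hom = consecutive⇒isWalk k f edge
    where
    implies : ∀ {a b} → not a ∨ b ≡ true → a ≡ true → b ≡ true
    implies b refl = b
    edge : ∀ i j → adjPath k i j ≡ true → adj H (lookup f i) (lookup f j) ≡ true
    edge i j = implies (and-map-tabulate _ id (and-map-tabulate _ id hom i) j)

  homPath≤sum-walkCount : ∀ k → homPath (suc k) H ≤ sum (map (walkCount k) (allFin (size H)))
  homPath≤sum-walkCount k = begin
    homPath (suc k) H                         ≡⟨ length-filter-T? _ (allVecs (size H) (suc k)) ⟩
    count (isHom (suc k) (adjPath (suc k)) H) (allVecs (size H) (suc k))
      ≤⟨ count-mono _ _ (isHom⇒isWalk (suc k)) (allVecs (size H) (suc k)) ⟩
    count isWalk (allVecs (size H) (suc k))   ≡⟨ count-walks k ⟩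
    sum (map (walkCount k) (allFin (size H))) ∎
    where open ≤-Reasoning

  walkCount-suc-≤ : ∀ t {X} → (∀ w → walkCount t w ≤ X) → ∀ v → walkCount (suc t) v ≤ degree H v * X
  walkCount-suc-≤ t bound v = sum-if-≤ (adj H v) (walkCount t) bound (allFin (size H))

  walkCount-suc-slack : ∀ t {X B v w} → (∀ w → walkCount t w ≤ X) → adj H v w ≡ true →
                        walkCount t w + B ≤ X → walkCount (suc t) v + B ≤ degree H v * X
  walkCount-suc-slack t {v = v} {w} bound v~w slack =
    sum-if-slack (adj H v) (walkCount t) bound v~w slack (allFin (size H)) (∈-allFin w)

  degree≤maxDegree : ∀ v → degree H v ≤ maxDegree H
  degree≤maxDegree v = foldr-⊔-upper (degree H) (allFin (size H)) (∈-allFin v)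

  nonRegular⇒lowDegree : ¬ Regular H → ∃ λ u → degree H u < maxDegree H
  nonRegular⇒lowDegree nonRegular with any? (λ u → degree H u <? maxDegree H)
  ... | yes low = low
  ... | no  none = ⊥-elim (nonRegular λ v w → trans (≡maxDegree v) (sym (≡maxDegree w)))
    where
    ≡maxDegree : ∀ v → degree H v ≡ maxDegree H
    ≡maxDegree v = ≤-antisym (degree≤maxDegree v) (≮⇒≥ (λ low → none (v , low)))

reachLength : ∀ {H u v} → Reach H u v → ℕ
reachLength here       = 0
reachLength (step _ r) = suc (reachLength r)

-- A Bernoulli-type inequality

^-bernoulli : ∀ c q → c ^ q * (c + q) ≤ c * suc c ^ q
^-bernoulli c zero = ≤-reflexive (base c)
  where
  base : ∀ c → 1 * (c + 0) ≡ c * 1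
  base = solve-∀
^-bernoulli c (suc q) = begin
  c ^ suc q * (c + suc q)        ≡⟨ shift c (c ^ q) q ⟩
  c ^ q * (c * (c + suc q))      ≤⟨ *-monoʳ-≤ (c ^ q) (m≤m+n _ q) ⟩
  c ^ q * (c * (c + suc q) + q)  ≡⟨ expand c (c ^ q) q ⟩
  suc c * (c ^ q * (c + q))      ≤⟨ *-monoʳ-≤ (suc c) (^-bernoulli c q) ⟩
  suc c * (c * suc c ^ q)        ≡⟨ swap (suc c) c (suc c ^ q) ⟩
  c * suc c ^ suc q              ∎
  where
  open ≤-Reasoning
  shift : ∀ c x q → c * x * (c + suc q) ≡ x * (c * (c + suc q))
  shift = solve-∀
  expand : ∀ c x q → x * (c * (c + suc q) + q) ≡ suc c * (x * (c + q))
  expand = solve-∀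
  swap : ∀ a b y → a * (b * y) ≡ b * (a * y)
  swap = solve-∀

n*c^Q<[1+c]^Q : ∀ n c → let Q = n * c + 1 in n * c ^ Q < suc c ^ Q
n*c^Q<[1+c]^Q n zero rewrite *-zeroʳ n | *-zeroʳ n = s≤s z≤n
n*c^Q<[1+c]^Q n c@(suc _) = *-cancelˡ-< c (n * c ^ Q) (suc c ^ Q) (begin-strict
  c * (n * c ^ Q)  ≡⟨ swap c n (c ^ Q) ⟩
  c ^ Q * (n * c)  <⟨ *-monoʳ-< (c ^ Q) {{m^n≢0 c Q}} (≤-trans (≤-reflexive (+-comm 1 (n * c))) (m≤n+m Q c)) ⟩
  c ^ Q * (c + Q)  ≤⟨ ^-bernoulli c Q ⟩
  c * suc c ^ Q    ∎)
  where
  open ≤-Reasoning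
  Q = n * c + 1
  swap : ∀ c n x → c * (n * x) ≡ x * (n * c)
  swap = solve-∀

-- Exponential decay of walk counts

module WalkDecay (H : Graph) (conn : Connected H) (u : Fin (size H)) (u-low : degree H u < maxDegree H) where

  Δ : ℕ
  Δ = maxDegree H

  instance
    Δ-nonZero : NonZero Δ
    Δ-nonZero = >-nonZero (≤-<-trans z≤n u-low)

  walkCount-suc-≤Δ : ∀ t {X} → (∀ w → walkCount H t w ≤ X) → ∀ v → walkCount H (suc t) v ≤ Δ * X
  walkCount-suc-≤Δ t {X} bound v = ≤-trans (walkCount-suc-≤ H t bound v) (*-monoˡ-≤ X (degree≤maxDegree H v))

  module _ {k B : ℕ} (bound : ∀ w → walkCount H k w ≤ B) where

    walkCount-growth : ∀ j v → walkCount H (j + k) v ≤ Δ ^ j * B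
    walkCount-growth zero    v = ≤-trans (bound v) (≤-reflexive (sym (*-identityˡ B)))
    walkCount-growth (suc j) v = ≤-trans (walkCount-suc-≤Δ (j + k) (walkCount-growth j) v) (≤-reflexive (sym (*-assoc Δ (Δ ^ j) B)))

    walkCount-deficit : ∀ {v} (r : Reach H v u) {a} → reachLength r < a → walkCount H (a + k) v + B ≤ Δ ^ a * B
    walkCount-deficit here {suc a} _ = begin
      walkCount H (suc a + k) u + B  ≤⟨ +-mono-≤ (walkCount-suc-≤ H (a + k) (walkCount-growth a) u) B≤X ⟩
      degree H u * X + X             ≡⟨ +-comm _ X ⟩
      suc (degree H u) * X           ≤⟨ *-monoˡ-≤ X u-low ⟩
      Δ * X                          ≡⟨ *-assoc Δ (Δ ^ a) B ⟨
      Δ ^ suc a * B                  ∎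
      where
      open ≤-Reasoning
      X = Δ ^ a * B
      B≤X : B ≤ X
      B≤X = ≤-trans (≤-reflexive (sym (*-identityˡ B))) (*-monoˡ-≤ B (m^n>0 Δ a))
    walkCount-deficit {v} (step v~w r) {suc a} (s≤s r<a) = begin
      walkCount H (suc a + k) v + B  ≤⟨ walkCount-suc-slack H (a + k) (walkCount-growth a) v~w (walkCount-deficit r r<a) ⟩
      degree H v * X                 ≤⟨ *-monoˡ-≤ X (degree≤maxDegree H v) ⟩
      Δ * X                          ≡⟨ *-assoc Δ (Δ ^ a) B ⟨
      Δ ^ suc a * B                  ∎
      where
      open ≤-Reasoning
      X = Δ ^ a * B

  radius : ℕ
  radius = foldr _⊔_ 0 (map (λ v → reachLength (conn v u)) (allFin (size H)))

  m : ℕ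
  m = suc radius

  c : ℕ
  c = pred (Δ ^ m)

  suc-c : suc c ≡ Δ ^ m
  suc-c = suc-pred (Δ ^ m) {{m^n≢0 Δ m}}

  walkCount-contract : ∀ {k B} → (∀ w → walkCount H k w ≤ B) → ∀ v → walkCount H (m + k) v ≤ c * B
  walkCount-contract {k} {B} bound v = +-cancelˡ-≤ B _ _ (begin
    B + walkCount H (m + k) v  ≡⟨ +-comm B _ ⟩
    walkCount H (m + k) v + B  ≤⟨ walkCount-deficit bound (conn v u) within-radius ⟩
    Δ ^ m * B                  ≡⟨ cong (_* B) suc-c ⟨
    suc c * B                  ∎)
    where
    open ≤-Reasoning
    within-radius : reachLength (conn v u) < m
    within-radius = s≤s (foldr-⊔-upper (λ v → reachLength (conn v u)) (allFin (size H)) (∈-allFin v))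

  walkCount-≤ : ∀ r q v → walkCount H (r + q * m) v ≤ Δ ^ r * c ^ q
  walkCount-≤ r q = walkCount-growth (contracted q) r
    where
    contracted : ∀ q v → walkCount H (q * m) v ≤ c ^ q
    contracted zero    v = ≤-refl
    contracted (suc q) v = walkCount-contract (contracted q) v

  homPath-≤ : ∀ r q → homPath (suc (r + q * m)) H ≤ size H * (Δ ^ r * c ^ q)
  homPath-≤ r q = begin
    homPath (suc (r + q * m)) H                                    ≤⟨ homPath≤sum-walkCount H (r + q * m) ⟩
    sum (map (walkCount H (r + q * m)) (allFin (size H)))           ≤⟨ sum-≤-length* _ (walkCount-≤ r q) (allFin (size H)) ⟩
    length (allFin (size H)) * (Δ ^ r * c ^ q)                      ≡⟨ cong (_* (Δ ^ r * c ^ q)) (length-tabulate {n = size H} id) ⟩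
    size H * (Δ ^ r * c ^ q)                                       ∎
    where open ≤-Reasoning

  homPath-eventually-< : ∀ D → Eventually λ k → homPath k H * Δ ^ D < Δ ^ k
  homPath-eventually-< D = suc (Q * m) , beyond
    where
    K = size H * Δ ^ D
    Q = K * c + 1
    rearrange : ∀ n a b d → n * (a * b) * d ≡ a * (n * d * b)
    rearrange = solve-∀
    small : ∀ r → homPath (suc (r + Q * m)) H * Δ ^ D < Δ ^ suc (r + Q * m)
    small r = begin-strict
      homPath (suc (r + Q * m)) H * Δ ^ D  ≤⟨ *-monoˡ-≤ (Δ ^ D) (homPath-≤ r Q) ⟩
      size H * (Δ ^ r * c ^ Q) * Δ ^ D     ≡⟨ rearrange (size H) (Δ ^ r) (c ^ Q) (Δ ^ D) ⟩
      Δ ^ r * (K * c ^ Q)                  <⟨ *-monoʳ-< (Δ ^ r) {{m^n≢0 Δ r}} (n*c^Q<[1+c]^Q K c) ⟩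
      Δ ^ r * suc c ^ Q                    ≡⟨ cong (λ x → Δ ^ r * x ^ Q) suc-c ⟩
      Δ ^ r * (Δ ^ m) ^ Q                  ≡⟨ cong (Δ ^ r *_) (trans (^-*-assoc Δ m Q) (cong (Δ ^_) (*-comm m Q))) ⟩
      Δ ^ r * Δ ^ (Q * m)                  ≡⟨ ^-distribˡ-+-* Δ r (Q * m) ⟨
      Δ ^ (r + Q * m)                      ≤⟨ m≤n*m _ Δ ⟩
      Δ ^ suc (r + Q * m)                  ∎
      where open ≤-Reasoning
    beyond : ∀ k → k ≥ suc (Q * m) → homPath k H * Δ ^ D < Δ ^ k
    beyond (suc k) (s≤s Qm≤k) = subst (λ k → homPath (suc k) H * Δ ^ D < Δ ^ suc k) (m∸n+n≡m Qm≤k) (small (k ∸ Q * m))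

-- Integer exponents

<pow-of-*^< : ∀ {x Δ k} d → d ≤ k → x * Δ ^ d < Δ ^ k → x <pow Δ ^ (k −ℤ (ℤ.+ d))
<pow-of-*^< {x} {Δ} {k} d d≤k x*Δᵈ<Δᵏ =
  subst (λ e → x <pow Δ ^ e) (sym (trans (m-n≡m⊖n k d) (⊖-≥ d≤k)))
        (*-cancelʳ-< (Δ ^ d) x (Δ ^ (k ∸ d)) (subst (x * Δ ^ d <_) Δᵏ≡Δᵏ⁻ᵈ*Δᵈ x*Δᵈ<Δᵏ))
  where
  Δᵏ≡Δᵏ⁻ᵈ*Δᵈ : Δ ^ k ≡ Δ ^ (k ∸ d) * Δ ^ d
  Δᵏ≡Δᵏ⁻ᵈ*Δᵈ = trans (cong (Δ ^_) (sym (m∸n+n≡m d≤k))) (^-distribˡ-+-* Δ (k ∸ d) d)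

eventually-<pow : ∀ {Δ} .{{_ : NonZero Δ}} (x : ℕ → ℕ) δ → (∀ D → Eventually λ k → x k * Δ ^ D < Δ ^ k) →
                  Eventually λ k → x k <pow Δ ^ (k −ℤ δ)
eventually-<pow x (ℤ.+ d) small with small d
... | ℓ , beyond = ℓ ⊔ d , λ k ℓ⊔d≤k → <pow-of-*^< d (m⊔n≤o⇒n≤o ℓ d ℓ⊔d≤k) (beyond k (m⊔n≤o⇒m≤o ℓ d ℓ⊔d≤k))
eventually-<pow {Δ} x -[1+ d ] small with small 0
... | ℓ , beyond = ℓ , λ k ℓ≤k →
  <-≤-trans (subst (_< Δ ^ k) (*-identityʳ (x k)) (beyond k ℓ≤k)) (^-monoʳ-≤ Δ (m≤m+n k (suc d)))

lemma1 : (δ : ℤ) (H : Graph) → Connected H → ¬ Regular H →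
    ∃ λ (ℓ : ℕ) → ∀ (k : ℕ) → k ≥ ℓ → homPath k H <pow maxDegree H ^ (k −ℤ δ)
lemma1 δ H conn nonRegular with nonRegular⇒lowDegree H nonRegular
... | u , u-low = eventually-<pow (λ k → homPath k H) δ homPath-eventually-<
  where open WalkDecay H conn u u-low
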